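{- Let $G=(V,E)$ be a finite simple graph and $\lambda\in\mathbb{Z}_{>0}^V$. Then \[ \widetilde{\chi}_G^\lambda \left( q, \frac{ 1 }{ 1-q } \right) \;=\; \sum_{\substack{\text{proper colorings}\\ c\,:\,V\to \mathbb{Z}_{ > 0 } }} q^{ \sum_{ v \in V } \lambda_v c(v) }, \] where the left side is the rational function in $q$ obtained by substituting $x=\frac1{1-q}$, and the equality is as formal (Laurent) power series in $q$. Consequently, \[ \widetilde{\chi}_G^{\mathbf 1} \left( q, \frac{ 1 }{ 1-q } \right) \;=\; X_G \left( q, q^2, q^3, \dots \right), \] where $\mathbf 1\in\mathbb{Z}^V$ is the all-ones vector.
   Context: A coloring $c$ is proper if $c(v)\ne c(w)$ whenever $vw\in E$. $\chi_G^\lambda(q,n):=\sum_c q^{\sum_v\lambda_v c(v)}$ over proper colorings $c:V\to\{1,\dots,n\}$; $\widetilde{\chi}^\lambda_G(q,x)$ is the unique polynomial in $\mathbb{Q}(q)[x]$ with $\widetilde{\chi}^\lambda_G(q,[n]_q)=\chi_G^\lambda(q,n)$ for all positive integers $n$, where $[n]_q=\frac{1-q^n}{1-q}$. Stanley's chromatic symmetric function is $X_G(x_1,x_2,\dots):=\sum_{c} x_1^{\#c^{ -1}(1)}x_2^{\#c^{ -1}(2)}\cdots$, summed over proper colorings $c:V\to\mathbb{Z}_{>0}$. -}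

module Defs where

open import Data.Nat as ℕ using (ℕ; zero; suc; _≤_; _∸_)
open import Data.Integer using (+_)
open import Data.Rational using (ℚ; 0ℚ; 1ℚ; _/_) renaming (_+_ to _+ℚ_; _*_ to _*ℚ_)
open import Data.Bool using (Bool; true; false; _∧_; _∨_; not)
open import Data.Fin using (Fin)
open import Data.Vec using (Vec; []; _∷_; lookup)
open import Data.List using (List; []; _∷_; map; concatMap; foldr; upTo; allFin; filter; length)
open import Data.Bool.ListAction using (all)
open import Data.Product using (Σ)
open import Relation.Binary.PropositionalEquality using (_≡_)
open import Function.Bundles using (_↔_)
open import Relation.Nullary using (yes; no)
open import Data.Empty using (⊥)
open import Data.Bool using (T; T?)

-- Formal power series over ℚ in the variable q:  coefficient functions.

Series : Set
Series = ℕ → ℚ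

_≈ₛ_ : Series → Series → Set
f ≈ₛ g = ∀ m → f m ≡ g m

infix 4 _≈ₛ_
infixl 6 _+ₛ_
infixl 7 _*ₛ_

_+ₛ_ : Series → Series → Series
(f +ₛ g) m = f m +ℚ g m

_*ₛ_ : Series → Series → Series
(f *ₛ g) m = foldr (λ i acc → (f i *ℚ g (m ∸ i)) +ℚ acc) 0ℚ (upTo (suc m))

0ₛ : Series
0ₛ _ = 0ℚ

1ₛ : Series
1ₛ zero    = 1ℚ
1ₛ (suc _) = 0ℚ

_^ₛ_ : Series → ℕ → Series
f ^ₛ zero  = 1ₛ
f ^ₛ suc k = f *ₛ (f ^ₛ k)

ℕ→ℚ : ℕ → ℚ
ℕ→ℚ k = (+ k) / 1

fromℕs : (ℕ → ℕ) → Series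
fromℕs s m = ℕ→ℚ (s m)

qpow : ℕ → Series
qpow w m with w ℕ.≟ m
... | yes _ = 1ℚ
... | no  _ = 0ℚ

-- Polynomials in q with rational coefficients: coefficient lists
-- (a₀ ∷ a₁ ∷ …) meaning a₀ + a₁ q + … .  Embedded into series.

Polyq : Set
Polyq = List ℚ

⟦_⟧ : Polyq → Series
⟦ [] ⟧     _       = 0ℚ
⟦ a ∷ _ ⟧  zero    = a
⟦ _ ∷ as ⟧ (suc m) = ⟦ as ⟧ m

NonZeroPoly : Polyq → Set
NonZeroPoly p = Σ ℕ (λ m → ⟦ p ⟧ m ≡ 0ℚ → ⊥)

qint : ℕ → Series
qint n m with m ℕ.<? n
... | yes _ = 1ℚ
... | no  _ = 0ℚ

-- 1/(1-q) = 1 + q + q² + … as a formal power series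
geom : Series
geom _ = 1ℚ

-- Polynomials in x with coefficients in ℚ(q).
-- Every element of ℚ(q)[x] can be written  (Σ_k N_k(q) x^k) / D(q)
-- with N_k, D ∈ ℚ[q], D ≠ 0.  We record such a presentation.

record RatPolyX : Set where
  field
    num : List Polyq     -- N₀, N₁, …, N_d   (coefficient of x^k is N_k / D)
    den : Polyq
    den≢0 : NonZeroPoly den

evalNum : List Polyq → Series → Series
evalNum ns X = go 0 ns
  where
    go : ℕ → List Polyq → Series
    go k []       = 0ₛ
    go k (p ∷ ps) = ⟦ p ⟧ *ₛ (X ^ₛ k) +ₛ go (suc k) ps

-- Finite simple graphs on vertex set Fin n, given by a Boolean
-- adjacency relation (symmetric and irreflexive, imposed in the theorem).

Adj : ℕ → Set
Adj n = Fin n → Fin n → Bool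

properᵇ : ∀ {n} → Adj n → Vec ℕ n → Bool
properᵇ {n} adj c =
  all (λ i → all (λ j → not (adj i j) ∨ not (lookup c i ℕ.≡ᵇ lookup c j)) (allFin n)) (allFin n)

weight : ∀ {n} → Vec ℕ n → Vec ℕ n → ℕ
weight []       []       = 0
weight (l ∷ ls) (c ∷ cs) = l ℕ.* c ℕ.+ weight ls cs

positiveᵇ : ∀ {n} → Vec ℕ n → Bool
positiveᵇ []       = true
positiveᵇ (c ∷ cs) = (1 ℕ.≤ᵇ c) ∧ positiveᵇ cs

colourings : (n k : ℕ) → List (Vec ℕ n)
colourings zero    k = [] ∷ []
colourings (suc n) k =
  concatMap (λ c → map (c ∷_) (colourings n k)) (map suc (upTo k))

chromλ : ∀ {n} → Adj n → Vec ℕ n → ℕ → Series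
chromλ {n} adj lam k =
  foldr (λ c acc → qpow (weight lam c) +ₛ acc) 0ₛ
        (filter (λ c → T? (properᵇ adj c)) (colourings n k))

ColouringsOfWeight : ∀ {n} → Adj n → Vec ℕ n → ℕ → Set
ColouringsOfWeight {n} adj lam m =
  Σ (Vec ℕ n) (λ c → T (positiveᵇ c ∧ properᵇ adj c ∧ (weight lam c ℕ.≡ᵇ m)))

{-# OPTIONS --safe #-}
-- The coefficient of q^m in a polynomial in x
-- over ℚ[q] depends only on x modulo q^(m+1), and 1/(1-q) ≡ [m+1]_q modulo
-- q^(m+1); so on the left x = 1/(1-q) may be replaced by x = [m+1]_q, where the
-- interpolation hypothesis applies.  On the right, since every λ_v ≥ 1, a
-- colouring of weight i ≤ m uses no colour above m, so the coefficient of q^i in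
-- χ^λ_G(q, m+1) already counts all proper colourings V → ℤ_{>0} of weight i.
module Submission where

open import Defs
open import Data.Nat using (ℕ; suc; _≤_)
open import Data.Bool using (Bool; true; false)
open import Data.Fin using (Fin)
import Data.Fin as Fin
open import Data.Vec using (Vec; lookup)
open import Data.Product using (_×_)
open import Relation.Binary.PropositionalEquality using (_≡_)
open import Function.Bundles using (_↔_)

open import Data.Nat using (zero; _<_; _<?_; _≡ᵇ_; _*_; _∸_; _≟_; z≤n; s≤s)
open import Data.Nat.Properties
  using (module ≤-Reasoning; <⇒≤; ≤-refl; ≤-trans; ≤-pred; ≤-reflexive; m∸n≤m; m≤m+n; m≤n+m; *-monoˡ-≤; *-identityˡ; suc-injective; ≡ᵇ⇒≡; ≡⇒≡ᵇ)
open import Data.Integer using (+_) renaming (_+_ to _+ℤ_)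
open import Data.Integer.Properties using (*-identityʳ)
open import Data.Rational using (0ℚ; 1ℚ; _/_) renaming (_+_ to _+ℚ_; _*_ to _*ℚ_)
open import Data.Rational.Properties using (normalize-coprime; +-identityˡ)
open import Data.Nat.Coprimality using (1-coprimeTo) renaming (sym to coprime-sym)
open import Data.Bool using (T; T?; _∧_)
open import Data.Bool.Properties using (T-∧; T-irrelevant)
open import Data.Vec using ([]; _∷_)
open import Data.Vec.Properties using (∷-injective)
open import Data.List using (List; []; _∷_; map; concatMap; foldr; upTo; filter; length; cartesianProductWith; _++_)
import Data.List as List
open import Data.List.Properties using (filter-accept; filter-reject)
open import Data.List.Relation.Unary.All using (All; []; _∷_)
open import Data.List.Relation.Unary.All.Properties using (applyUpTo⁺₁)
open import Data.List.Relation.Unary.Any using (here; there; index)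
open import Data.List.Relation.Unary.AllPairs using ([]; _∷_)
open import Data.List.Relation.Unary.Unique.Propositional using (Unique)
open import Data.List.Relation.Unary.Unique.Propositional.Properties using (cartesianProductWith⁺; map⁺; upTo⁺; filter⁺)
open import Data.List.Membership.Propositional using (_∈_)
open import Data.List.Membership.Propositional.Properties
  using (∈-cartesianProductWith⁺; ∈-cartesianProductWith⁻; ∈-map⁺; ∈-map⁻; ∈-upTo⁺; ∈-filter⁺; ∈-filter⁻; ∈-lookup)
open import Data.List.Membership.Propositional.Properties.WithK using (unique⇒irrelevant)
open import Data.Fin.Permutation using (↔⇒≡)
open import Data.Product using (∃; _,_; proj₂)
open import Data.Unit using (tt)
open import Function using (_∘_; _⇔_; mk⇔; Equivalence)
open import Function.Construct.Identity using (⇔-id)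
open import Data.Product.Function.NonDependent.Propositional using (_×-⇔_)
open import Function.Bundles using (mk↔ₛ′)
open import Function.Construct.Composition using (_↔-∘_; _⇔-∘_)
open import Relation.Binary.PropositionalEquality using (_≢_; refl; sym; trans; cong; cong₂; subst; module ≡-Reasoning)
open import Relation.Nullary using (yes; no; Dec)
open import Data.Empty using (⊥-elim)
import Relation.Unary as U

infix 4 _≈[≤_]_

_≈[≤_]_ : Series → ℕ → Series → Set
f ≈[≤ m ] g = ∀ {i} → i ≤ m → f i ≡ g i

foldr-cong-local : ∀ {A B : Set} {f g : A → B → B} {e : B} {xs : List A} →
  All (λ x → ∀ b → f x b ≡ g x b) xs → foldr f e xs ≡ foldr g e xs
foldr-cong-local [] = refl
foldr-cong-local {f = f} (f≗g ∷ fs≗gs) = trans (cong (f _) (foldr-cong-local fs≗gs)) (f≗g _)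

*ₛ-cong-≤ : ∀ {m f f′ g g′} → f ≈[≤ m ] f′ → g ≈[≤ m ] g′ → f *ₛ g ≈[≤ m ] f′ *ₛ g′
*ₛ-cong-≤ {f = f} {f′} {g} {g′} f≈f′ g≈g′ {i} i≤m =
  foldr-cong-local {f = λ j → f j *ℚ g (i ∸ j) +ℚ_} {g = λ j → f′ j *ℚ g′ (i ∸ j) +ℚ_}
    (applyUpTo⁺₁ _ (suc i) term-cong)
  where
  term-cong : ∀ {j} → j < suc i → ∀ acc → f j *ℚ g (i ∸ j) +ℚ acc ≡ f′ j *ℚ g′ (i ∸ j) +ℚ acc
  term-cong {j} j<1+i acc = cong (_+ℚ acc)
    (cong₂ _*ℚ_ (f≈f′ (≤-trans (≤-pred j<1+i) i≤m)) (g≈g′ (≤-trans (m∸n≤m i j) i≤m)))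

^ₛ-cong-≤ : ∀ {m X X′} → X ≈[≤ m ] X′ → ∀ k → X ^ₛ k ≈[≤ m ] X′ ^ₛ k
^ₛ-cong-≤ X≈X′ zero    _ = refl
^ₛ-cong-≤ X≈X′ (suc k)   = *ₛ-cong-≤ X≈X′ (^ₛ-cong-≤ X≈X′ k)

-- evalNum recurses through a where-bound helper of Defs that cannot be named
-- here.  The meta evalNumFrom is solved by unification against that helper in
-- evalNum-unfold₂ (the with-abstraction of the list and of the literal 2 turns
-- the constraint into a pattern), after which evalNum ns X is definitionally
-- evalNumFrom ns X 0 ns.
mutual
  evalNumFrom : List Polyq → Series → ℕ → List Polyq → Series
  evalNumFrom = _

  evalNum-unfold₂ : ∀ p q ps X →
    evalNum (p ∷ q ∷ ps) X ≡ ⟦ p ⟧ *ₛ (X ^ₛ 0) +ₛ (⟦ q ⟧ *ₛ (X ^ₛ 1) +ₛ evalNumFrom (p ∷ q ∷ ps) X 2 ps)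
  evalNum-unfold₂ p q ps X with p List.∷ q List.∷ ps | 2
  ... | _ | _ = refl

evalNumFrom-cong-≤ : ∀ {m X X′} → X ≈[≤ m ] X′ → ∀ ns k ps → evalNumFrom ns X k ps ≈[≤ m ] evalNumFrom ns X′ k ps
evalNumFrom-cong-≤ X≈X′ ns k []       _   = refl
evalNumFrom-cong-≤ X≈X′ ns k (p ∷ ps) i≤m =
  cong₂ _+ℚ_ (*ₛ-cong-≤ {f = ⟦ p ⟧} (λ _ → refl) (^ₛ-cong-≤ X≈X′ k) i≤m) (evalNumFrom-cong-≤ X≈X′ ns (suc k) ps i≤m)

evalNum-cong-≤ : ∀ {m X X′} → X ≈[≤ m ] X′ → ∀ ns → evalNum ns X ≈[≤ m ] evalNum ns X′
evalNum-cong-≤ X≈X′ ns = evalNumFrom-cong-≤ X≈X′ ns 0 ns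

geom≈qint : ∀ m → geom ≈[≤ m ] qint (suc m)
geom≈qint m {i} i≤m with i <? suc m
... | yes _   = refl
... | no i≮m = ⊥-elim (i≮m (s≤s i≤m))

∃∈↔Fin-length : ∀ {A : Set} (xs : List A) → (∃ λ x → x ∈ xs) ↔ Fin (length xs)
∃∈↔Fin-length xs = mk↔ₛ′ (index ∘ proj₂) (λ j → List.lookup xs j , ∈-lookup j) (index-∈-lookup xs) lookup-index-∈
  where
  index-∈-lookup : ∀ xs j → index (∈-lookup {xs = xs} j) ≡ j
  index-∈-lookup (_ ∷ _)  Fin.zero    = refl
  index-∈-lookup (_ ∷ xs) (Fin.suc j) = cong Fin.suc (index-∈-lookup xs j)
  lookup-index-∈ : ∀ {xs} (x∈ : ∃ λ x → x ∈ xs) → (List.lookup xs (index (proj₂ x∈)) , ∈-lookup (index (proj₂ x∈))) ≡ x∈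
  lookup-index-∈ (_ , here refl) = refl
  lookup-index-∈ (x , there x∈) = cong (λ (y , y∈) → y , there y∈) (lookup-index-∈ (x , x∈))

∃-cong-irrelevant : ∀ {A : Set} {P Q : A → Set} → U.Irrelevant P → U.Irrelevant Q →
  (∀ {x} → P x ⇔ Q x) → ∃ P ↔ ∃ Q
∃-cong-irrelevant P-irr Q-irr P⇔Q = mk↔ₛ′
  (λ (x , px) → x , Equivalence.to P⇔Q px) (λ (x , qx) → x , Equivalence.from P⇔Q qx)
  (λ (x , qx) → cong (x ,_) (Q-irr _ qx)) (λ (x , px) → cong (x ,_) (P-irr _ px))

length-unique-enumeration : ∀ {A : Set} {P : A → Set} {xs : List A} {s : ℕ} → U.Irrelevant P →
  Unique xs → (∀ {x} → P x ⇔ x ∈ xs) → Fin s ↔ ∃ P → s ≡ length xs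
length-unique-enumeration {xs = xs} P-irr xs-unique P⇔∈ Fin↔P =
  ↔⇒≡ (∃∈↔Fin-length xs ↔-∘ (∃-cong-irrelevant P-irr (unique⇒irrelevant xs-unique) P⇔∈ ↔-∘ Fin↔P))

ℕ→ℚ-suc : ∀ k → 1ℚ +ℚ ℕ→ℚ k ≡ ℕ→ℚ (suc k)
-- Once ℕ→ℚ k is rewritten to its normal form, the sum computes to (+ 1 + + k * + 1) / 1.
ℕ→ℚ-suc k = trans (cong (1ℚ +ℚ_) (normalize-coprime (coprime-sym (1-coprimeTo k))))
                  (cong (λ z → (+ 1 +ℤ z) / 1) (*-identityʳ (+ k)))

qpow-≡ : ∀ {w i} → w ≡ i → qpow w i ≡ 1ℚ
qpow-≡ {w} refl with w ≟ w
... | yes _   = refl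
... | no w≢w = ⊥-elim (w≢w refl)

qpow-≢ : ∀ {w i} → w ≢ i → qpow w i ≡ 0ℚ
qpow-≢ {w} {i} w≢i with w ≟ i
... | yes w≡i = ⊥-elim (w≢i w≡i)
... | no _    = refl

Σqpow : ∀ {A : Set} → (A → ℕ) → List A → Series
Σqpow w = foldr (λ x acc → qpow (w x) +ₛ acc) 0ₛ

coeff-Σqpow : ∀ {A : Set} (w : A → ℕ) (xs : List A) i →
  Σqpow w xs i ≡ ℕ→ℚ (length (filter (λ x → w x ≟ i) xs))
coeff-Σqpow w []       i = refl
coeff-Σqpow w (x ∷ xs) i = cons (w x ≟ i)
  where
  open ≡-Reasoning
  w≟i : ∀ y → Dec (w y ≡ i)
  w≟i y = w y ≟ i
  cons : Dec (w x ≡ i) → qpow (w x) i +ℚ Σqpow w xs i ≡ ℕ→ℚ (length (filter w≟i (x ∷ xs)))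
  cons (yes wx≡i) = begin
    qpow (w x) i +ℚ Σqpow w xs i            ≡⟨ cong₂ _+ℚ_ (qpow-≡ wx≡i) (coeff-Σqpow w xs i) ⟩
    1ℚ +ℚ ℕ→ℚ (length (filter w≟i xs))     ≡⟨ ℕ→ℚ-suc (length (filter w≟i xs)) ⟩
    ℕ→ℚ (length (x ∷ filter w≟i xs))       ≡⟨ cong (ℕ→ℚ ∘ length) (filter-accept w≟i wx≡i) ⟨
    ℕ→ℚ (length (filter w≟i (x ∷ xs)))     ∎
  cons (no wx≢i) = begin
    qpow (w x) i +ℚ Σqpow w xs i            ≡⟨ cong₂ _+ℚ_ (qpow-≢ wx≢i) (coeff-Σqpow w xs i) ⟩
    0ℚ +ℚ ℕ→ℚ (length (filter w≟i xs))     ≡⟨ +-identityˡ _ ⟩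
    ℕ→ℚ (length (filter w≟i xs))           ≡⟨ cong (ℕ→ℚ ∘ length) (filter-reject w≟i wx≢i) ⟨
    ℕ→ℚ (length (filter w≟i (x ∷ xs)))     ∎

concatMap≡cartesianProductWith : ∀ {A B C : Set} (f : A → B → C) xs ys →
  concatMap (λ x → map (f x) ys) xs ≡ cartesianProductWith f xs ys
concatMap≡cartesianProductWith f []       ys = refl
concatMap≡cartesianProductWith f (x ∷ xs) ys = cong (map (f x) ys ++_) (concatMap≡cartesianProductWith f xs ys)

colourings-suc : ∀ n K → colourings (suc n) K ≡ cartesianProductWith _∷_ (map suc (upTo K)) (colourings n K)
colourings-suc n K = concatMap≡cartesianProductWith _∷_ (map suc (upTo K)) (colourings n K)

colourings-unique : ∀ n K → Unique (colourings n K)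
colourings-unique zero    K = [] ∷ []
colourings-unique (suc n) K = subst Unique (sym (colourings-suc n K))
  (cartesianProductWith⁺ _∷_ ∷-injective (map⁺ suc-injective (upTo⁺ K)) (colourings-unique n K))

∈-colourings⁻ : ∀ {n K} {c : Vec ℕ n} → c ∈ colourings n K → T (positiveᵇ c)
∈-colourings⁻ {zero}      {c = []} _ = tt
∈-colourings⁻ {suc n} {K} {c}      c∈
  with ∈-cartesianProductWith⁻ _∷_ (map suc (upTo K)) (colourings n K) (subst (c ∈_) (colourings-suc n K) c∈)
... | _ , cs , x∈ , cs∈ , refl with ∈-map⁻ suc x∈
... | _ , _ , refl = ∈-colourings⁻ cs∈

∈-colourings⁺ : ∀ {n K} {c : Vec ℕ n} → T (positiveᵇ c) → (∀ v → lookup c v ≤ K) → c ∈ colourings n K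
∈-colourings⁺ {c = []}                     _        _       = here refl
∈-colourings⁺ {c = zero ∷ _}               ()
∈-colourings⁺ {suc n} {K} {c = suc x ∷ cs} positive bounded = subst (_ ∈_) (sym (colourings-suc n K))
  (∈-cartesianProductWith⁺ _∷_ (∈-map⁺ suc (∈-upTo⁺ (bounded Fin.zero))) (∈-colourings⁺ positive (bounded ∘ Fin.suc)))

lookup-*≤weight : ∀ {n} (lam c : Vec ℕ n) v → lookup lam v * lookup c v ≤ weight lam c
lookup-*≤weight (l ∷ ls) (x ∷ cs) Fin.zero    = m≤m+n (l * x) (weight ls cs)
lookup-*≤weight (l ∷ ls) (x ∷ cs) (Fin.suc v) = ≤-trans (lookup-*≤weight ls cs v) (m≤n+m (weight ls cs) (l * x))

lookup≤weight : ∀ {n} (lam c : Vec ℕ n) → (∀ v → 1 ≤ lookup lam v) → ∀ v → lookup c v ≤ weight lam c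
lookup≤weight lam c lam≥1 v = begin
  lookup c v                ≡⟨ *-identityˡ (lookup c v) ⟨
  1 * lookup c v            ≤⟨ *-monoˡ-≤ (lookup c v) (lam≥1 v) ⟩
  lookup lam v * lookup c v ≤⟨ lookup-*≤weight lam c v ⟩
  weight lam c              ∎
  where open ≤-Reasoning

T-∧³ : ∀ x y z → T (x ∧ y ∧ z) ⇔ (T x × T y × T z)
T-∧³ x y z = (⇔-id _ ×-⇔ T-∧ {y} {z}) ⇔-∘ T-∧ {x} {y ∧ z}

module _ {n} (adj : Adj n) (lam : Vec ℕ n) (lam≥1 : ∀ v → 1 ≤ lookup lam v) where

  properColourings : ℕ → List (Vec ℕ n)
  properColourings K = filter (λ c → T? (properᵇ adj c)) (colourings n K)

  properColouringsOfWeight : ℕ → ℕ → List (Vec ℕ n)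
  properColouringsOfWeight K i = filter (λ c → weight lam c ≟ i) (properColourings K)

  ∈-properColouringsOfWeight : ∀ {K i c} → i < K →
    T (positiveᵇ c ∧ properᵇ adj c ∧ (weight lam c ≡ᵇ i)) ⇔ c ∈ properColouringsOfWeight K i
  ∈-properColouringsOfWeight {K} {i} {c} i<K = mk⇔ to from
    where
    to : T (positiveᵇ c ∧ properᵇ adj c ∧ (weight lam c ≡ᵇ i)) → c ∈ properColouringsOfWeight K i
    to t with Equivalence.to (T-∧³ (positiveᵇ c) (properᵇ adj c) (weight lam c ≡ᵇ i)) t
    ... | positive , proper , weight≡ᵇi = ∈-filter⁺ _ (∈-filter⁺ _ (∈-colourings⁺ positive bounded) proper) weight≡i
      where
      weight≡i : weight lam c ≡ i
      weight≡i = ≡ᵇ⇒≡ (weight lam c) i weight≡ᵇi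
      bounded : ∀ v → lookup c v ≤ K
      bounded v = ≤-trans (lookup≤weight lam c lam≥1 v) (≤-trans (≤-reflexive weight≡i) (<⇒≤ i<K))
    from : c ∈ properColouringsOfWeight K i → T (positiveᵇ c ∧ properᵇ adj c ∧ (weight lam c ≡ᵇ i))
    from c∈ with ∈-filter⁻ _ c∈
    ... | c∈proper , weight≡i with ∈-filter⁻ _ c∈proper
    ... | c∈colourings , proper = Equivalence.from (T-∧³ (positiveᵇ c) (properᵇ adj c) (weight lam c ≡ᵇ i))
      (∈-colourings⁻ c∈colourings , proper , ≡⇒≡ᵇ (weight lam c) i weight≡i)

  chromλ≈[≤]fromℕs : ∀ (s : ℕ → ℕ) → (∀ i → Fin (s i) ↔ ColouringsOfWeight adj lam i) →
    ∀ m → chromλ adj lam (suc m) ≈[≤ m ] fromℕs s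
  chromλ≈[≤]fromℕs s enumeration m {i} i≤m = begin
    chromλ adj lam (suc m) i                                   ≡⟨ coeff-Σqpow (weight lam) (properColourings (suc m)) i ⟩
    ℕ→ℚ (length (properColouringsOfWeight (suc m) i))          ≡⟨ cong ℕ→ℚ s≡length ⟨
    ℕ→ℚ (s i)                                                  ∎
    where
    open ≡-Reasoning
    unique : Unique (properColouringsOfWeight (suc m) i)
    unique = filter⁺ _ (filter⁺ _ (colourings-unique n (suc m)))
    s≡length : s i ≡ length (properColouringsOfWeight (suc m) i)
    s≡length = length-unique-enumeration T-irrelevant unique (∈-properColouringsOfWeight (s≤s i≤m)) (enumeration i)

theorem8 : (n : ℕ) (adj : Adj n)
  → (∀ i j → adj i j ≡ adj j i)
  → (∀ i → adj i i ≡ false)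
  → (lam : Vec ℕ n) → (∀ v → 1 ≤ lookup lam v)
  → (P : RatPolyX)
  → (∀ k → 1 ≤ k →
       evalNum (RatPolyX.num P) (qint k) ≈ₛ ⟦ RatPolyX.den P ⟧ *ₛ chromλ adj lam k)
  → (s : ℕ → ℕ) → (∀ m → Fin (s m) ↔ ColouringsOfWeight adj lam m)
  → evalNum (RatPolyX.num P) geom ≈ₛ ⟦ RatPolyX.den P ⟧ *ₛ fromℕs s
theorem8 n adj _ _ lam lam≥1 P interpolates s enumeration m = begin
  evalNum N geom m                            ≡⟨ evalNum-cong-≤ (geom≈qint m) N ≤-refl ⟩
  evalNum N (qint (suc m)) m                  ≡⟨ interpolates (suc m) (s≤s z≤n) m ⟩
  (⟦ D ⟧ *ₛ chromλ adj lam (suc m)) m         ≡⟨ *ₛ-cong-≤ {f = ⟦ D ⟧} (λ _ → refl) chromλ≈ ≤-refl ⟩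
  (⟦ D ⟧ *ₛ fromℕs s) m                       ∎
  where
  open ≡-Reasoning
  open RatPolyX P renaming (num to N; den to D)
  chromλ≈ : chromλ adj lam (suc m) ≈[≤ m ] fromℕs s
  chromλ≈ = chromλ≈[≤]fromℕs adj lam lam≥1 s enumeration m
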